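{- Let $n\geq 3$ and let $\pi=\pi_1\pi_2\cdots\pi_n\in\mathcal{S}_n$ be such that $\pi$ avoids both $231$ and $1432$ and $\pi^2$ avoids $231$. Then $\pi_1=n$, or $\pi_n=n$, or $\pi_{n-1}\pi_n=n(n-1)$ (i.e. $\pi_{n-1}=n$ and $\pi_n=n-1$).
   Context: $\mathcal{S}_n$ is the set of permutations of $[n]$, written as words with $\pi_i=\pi(i)$; $\pi^2=\pi\circ\pi$. A permutation contains a pattern $\sigma\in\mathcal{S}_k$ if some (not necessarily consecutive) subsequence of length $k$ is order isomorphic to $\sigma$; otherwise it avoids $\sigma$. -}

module Defs where

open import Data.Nat.Base using (ℕ)
open import Data.Fin.Base using (Fin; _<_; zero; suc)
open import Data.Product.Base using (Σ; _×_)
open import Function.Bundles using (_⇔_)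
open import Relation.Nullary using (¬_)

-- A word σ₁…σ_k of length k with letters in Fin m (entries of a permutation
-- use values 0..n-1 instead of 1..n; order is what matters).
-- w contains the pattern σ (of length k) if there is a strictly increasing
-- choice of positions f : Fin k → Fin n such that the subsequence
-- w(f 0) … w(f (k-1)) is order isomorphic to σ.
Contains : ∀ {n k} → (Fin n → Fin n) → (Fin k → Fin k) → Set
Contains {n} {k} w σ =
  Σ (Fin k → Fin n) λ f →
    (∀ i j → i < j → f i < f j) ×
    (∀ i j → (w (f i) < w (f j)) ⇔ (σ i < σ j))

Avoids : ∀ {n k} → (Fin n → Fin n) → (Fin k → Fin k) → Set
Avoids w σ = ¬ Contains w σ

p231 : Fin 3 → Fin 3
p231 zero = suc zero
p231 (suc zero) = suc (suc zero)
p231 (suc (suc zero)) = zero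

p1432 : Fin 4 → Fin 4
p1432 zero = zero
p1432 (suc zero) = suc (suc (suc zero))
p1432 (suc (suc zero)) = suc (suc zero)
p1432 (suc (suc (suc zero))) = suc zero

-- Let p be the position of the maximum n. Avoiding 231 puts every entry left of p below every
-- entry right of p; if p > 1, avoiding 1432 (with π₁ playing the 1) then makes the entries right
-- of p increase. So when n is neither first nor last, πₙ = n − 1 and every j > p has πⱼ < j.
-- If moreover p < n − 1, the value p cannot lie left of p (π_{p+1} would be squeezed strictly
-- between p and p + 1) nor at p, so it lies at some q > p, and π² reads n − 1, n, π_{n−1} at the
-- positions p < q < n: a 231, since π_{n−1} < πₙ = n − 1.

module Submission where

open import Defs
open import Data.Nat.Base as ℕ using (ℕ; zero; suc; 2+; z≤n; z<s)
import Data.Nat.Properties as ℕ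
open import Data.Fin.Base using (Fin; zero; suc; fromℕ; inject₁; _<_; _≤_)
open import Data.Fin.Patterns using (0F; 1F; 2F)
open import Data.Fin.Properties
  using ( _≟_; <-cmp; <-trans; <-asym; <-irrefl; <⇒≢; ≤∧≢⇒<; <⇒≤pred; ≤-refl; ≤fromℕ
        ; ≤̄⇒inject₁<; fromℕ≢inject₁)
open import Data.Fin.Induction using (>-weakInduction)
open import Data.Fin.Permutation using (Permutation′; _⟨$⟩ʳ_; _⟨$⟩ˡ_; inverseʳ)
open import Data.Vec.Functional using ([]; _∷_)
open import Data.Product.Base using (∃; _×_; _,_)
open import Data.Sum.Base using (_⊎_; inj₁; inj₂)
open import Function.Base using (_∘_)
open import Function.Bundles using (_⇔_; mk⇔; Injection)
open import Function.Properties.Inverse using (↔⇒↣)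
open import Relation.Binary.Definitions using (tri<; tri≈; tri>)
open import Relation.Binary.PropositionalEquality
  using (_≡_; _≢_; refl; sym; trans; cong; subst; subst₂; module ≡-Reasoning)
open import Relation.Nullary using (¬_; yes; no; contradiction)
open ≡-Reasoning

Ascending : ∀ {k n} → (Fin (suc k) → Fin n) → Set
Ascending {k} g = ∀ (i : Fin k) → g (inject₁ i) < g (suc i)

ascending⇒strictlyIncreasing : ∀ {k n} {g : Fin (suc k) → Fin n} →
  Ascending g → ∀ {i j} → i < j → g i < g j
ascending⇒strictlyIncreasing g↑ {_}     {zero}        ()
ascending⇒strictlyIncreasing g↑ {zero}  {suc zero}    _   = g↑ zero
ascending⇒strictlyIncreasing {g = g} g↑ {zero} {suc (suc j)} _ =
  <-trans (g↑ zero) (ascending⇒strictlyIncreasing {g = g ∘ suc} (g↑ ∘ suc) {zero} {suc j} z<s)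
ascending⇒strictlyIncreasing {suc k} {g = g} g↑ {suc i} {suc j} i<j =
  ascending⇒strictlyIncreasing {g = g ∘ suc} (g↑ ∘ suc) (ℕ.s<s⁻¹ i<j)

ascending⇒<-⇔ : ∀ {k n} {g : Fin (suc k) → Fin n} →
  Ascending g → ∀ i j → (g i < g j) ⇔ (i < j)
ascending⇒<-⇔ {g = g} g↑ i j = mk⇔ reflect (ascending⇒strictlyIncreasing g↑)
  where
  reflect : g i < g j → i < j
  reflect gi<gj with <-cmp i j
  ... | tri< i<j _ _ = i<j
  ... | tri≈ _ refl _ = contradiction gi<gj (<-irrefl refl)
  ... | tri> _ _ j<i = contradiction gi<gj (<-asym (ascending⇒strictlyIncreasing g↑ j<i))

-- τ lists the positions of the pattern σ by increasing value.
contains-byRank : ∀ {n k} (w : Fin n → Fin n) (σ τ : Fin (suc k) → Fin (suc k)) →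
  (∀ i → τ (σ i) ≡ i) → (f : Fin (suc k) → Fin n) →
  Ascending f → Ascending (w ∘ f ∘ τ) → Contains w σ
contains-byRank w σ τ τ∘σ f f↑ wfτ↑ =
  f , (λ _ _ → ascending⇒strictlyIncreasing f↑) , values
  where
  values : ∀ i j → (w (f i) < w (f j)) ⇔ (σ i < σ j)
  values i j = subst₂ (λ x y → (w (f x) < w (f y)) ⇔ (σ i < σ j)) (τ∘σ i) (τ∘σ j)
                 (ascending⇒<-⇔ {g = w ∘ f ∘ τ} wfτ↑ (σ i) (σ j))

contains-231 : ∀ {n} (w : Fin n → Fin n) {a b c} → a < b → b < c →
  w c < w a → w a < w b → Contains w p231
contains-231 w {a} {b} {c} a<b b<c wc<wa wa<wb =
  contains-byRank w p231 (2F ∷ 0F ∷ 1F ∷ []) τ∘σ (a ∷ b ∷ c ∷ [])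
    (λ { zero → a<b ; (suc zero) → b<c })
    (λ { zero → wc<wa ; (suc zero) → wa<wb })
  where
  τ∘σ : ∀ i → _ ≡ i
  τ∘σ zero = refl
  τ∘σ (suc zero) = refl
  τ∘σ (suc (suc zero)) = refl

contains-1432 : ∀ {n} (w : Fin n → Fin n) {a b c d} → a < b → b < c → c < d →
  w a < w d → w d < w c → w c < w b → Contains w p1432
contains-1432 w {a} {b} {c} {d} a<b b<c c<d wa<wd wd<wc wc<wb =
  contains-byRank w p1432 p1432 p1432-involutive (a ∷ b ∷ c ∷ d ∷ [])
    (λ { zero → a<b ; (suc zero) → b<c ; (suc (suc zero)) → c<d })
    (λ { zero → wa<wd ; (suc zero) → wd<wc ; (suc (suc zero)) → wc<wb })
  where
  p1432-involutive : ∀ i → p1432 (p1432 i) ≡ i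
  p1432-involutive zero = refl
  p1432-involutive (suc zero) = refl
  p1432-involutive (suc (suc zero)) = refl
  p1432-involutive (suc (suc (suc zero))) = refl

<fromℕ⇒inject₁ : ∀ {n} {i : Fin (suc n)} → i < fromℕ n → ∃ λ i₀ → inject₁ i₀ ≡ i
<fromℕ⇒inject₁ {zero}  {zero}  ()
<fromℕ⇒inject₁ {suc n} {zero}  _   = zero , refl
<fromℕ⇒inject₁ {suc n} {suc i} i<n with <fromℕ⇒inject₁ (ℕ.s<s⁻¹ i<n)
... | i₀ , eq = suc i₀ , cong suc eq

increasing⇒below-diagonal : ∀ {n} (g : Fin (suc n) → Fin (suc n)) {p} →
  (∀ {i j} → p < i → i < j → g i < g j) → g (fromℕ n) < fromℕ n →
  ∀ {j} → p < j → g j < j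
increasing⇒below-diagonal g {p} g↑ g[last]<last {j} =
  >-weakInduction (λ j → p < j → g j < j) (λ _ → g[last]<last) step j
  where
  step : ∀ i → (p < suc i → g (suc i) < suc i) → p < inject₁ i → g (inject₁ i) < inject₁ i
  step i below p<i = ℕ.<-≤-trans (g↑ p<i i<i+1) (<⇒≤pred (below (<-trans p<i i<i+1)))
    where i<i+1 = ≤̄⇒inject₁< ≤-refl

module _ {n} (π : Permutation′ n) where

  ⟨$⟩ʳ-injective : ∀ {i j} → π ⟨$⟩ʳ i ≡ π ⟨$⟩ʳ j → i ≡ j
  ⟨$⟩ʳ-injective = Injection.injective (↔⇒↣ π)

  ⟨$⟩ʳ-<-or-> : ∀ {i j} → i ≢ j → π ⟨$⟩ʳ i < π ⟨$⟩ʳ j ⊎ π ⟨$⟩ʳ j < π ⟨$⟩ʳ i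
  ⟨$⟩ʳ-<-or-> {i} {j} i≢j with <-cmp (π ⟨$⟩ʳ i) (π ⟨$⟩ʳ j)
  ... | tri< πi<πj _ _ = inj₁ πi<πj
  ... | tri≈ _ πi≡πj _ = contradiction (⟨$⟩ʳ-injective πi≡πj) i≢j
  ... | tri> _ _ πj<πi = inj₂ πj<πi

  avoids-231⇒< : Avoids (π ⟨$⟩ʳ_) p231 → ∀ {i p j} → i < p → p < j →
    π ⟨$⟩ʳ i < π ⟨$⟩ʳ p → π ⟨$⟩ʳ i < π ⟨$⟩ʳ j
  avoids-231⇒< avoids {i} {p} {j} i<p p<j πi<πp with ⟨$⟩ʳ-<-or-> (<⇒≢ (<-trans i<p p<j))
  ... | inj₁ πi<πj = πi<πj
  ... | inj₂ πj<πi = contradiction (contains-231 (π ⟨$⟩ʳ_) i<p p<j πj<πi πi<πp) avoids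

  avoids-1432⇒< : Avoids (π ⟨$⟩ʳ_) p1432 → ∀ {a p i j} → a < p → p < i → i < j →
    π ⟨$⟩ʳ a < π ⟨$⟩ʳ j → π ⟨$⟩ʳ i < π ⟨$⟩ʳ p → π ⟨$⟩ʳ i < π ⟨$⟩ʳ j
  avoids-1432⇒< avoids a<p p<i i<j πa<πj πi<πp with ⟨$⟩ʳ-<-or-> (<⇒≢ i<j)
  ... | inj₁ πi<πj = πi<πj
  ... | inj₂ πj<πi = contradiction (contains-1432 (π ⟨$⟩ʳ_) a<p p<i i<j πa<πj πj<πi πi<πp) avoids

below-max : ∀ {n} (π : Permutation′ (suc n)) {p i} →
  π ⟨$⟩ʳ p ≡ fromℕ n → i ≢ p → π ⟨$⟩ʳ i < fromℕ n
below-max π π[p]≡max i≢p =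
  ≤∧≢⇒< (≤fromℕ _) (λ πi≡max → i≢p (⟨$⟩ʳ-injective π (trans πi≡max (sym π[p]≡max))))

penultimate : ∀ n → Fin (2+ n)
penultimate n = inject₁ (fromℕ n)

second-largest : ∀ {n} (π : Permutation′ (2+ n)) {p y} → π ⟨$⟩ʳ p ≡ fromℕ (suc n) → y ≢ p →
  (∀ {i} → i ≢ p → i ≢ y → π ⟨$⟩ʳ i < π ⟨$⟩ʳ y) → π ⟨$⟩ʳ y ≡ penultimate n
second-largest {n} π {p} {y} π[p]≡max y≢p below-y with x ≟ y | x ≟ p
  where x = π ⟨$⟩ˡ penultimate n
... | yes refl | _        = inverseʳ π
... | no _     | yes refl = contradiction (trans (sym π[p]≡max) (inverseʳ π)) fromℕ≢inject₁
... | no x≢y   | no x≢p   = contradiction (subst (_< π ⟨$⟩ʳ y) (inverseʳ π) (below-y x≢p x≢y))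
                              (ℕ.≤⇒≯ (<⇒≤pred (below-max π π[p]≡max y≢p)))

module InteriorMaximum {n} (π : Permutation′ (2+ n))
  (avoids-231 : Avoids (π ⟨$⟩ʳ_) p231) (avoids-1432 : Avoids (π ⟨$⟩ʳ_) p1432)
  {p} (π[p]≡max : π ⟨$⟩ʳ p ≡ fromℕ (suc n)) (p≢0 : p ≢ zero) (p≢last : p ≢ fromℕ (suc n))
  where

  private
    0<p : zero {n = suc n} < p
    0<p = ≤∧≢⇒< z≤n (p≢0 ∘ sym)

    p<last : p < fromℕ (suc n)
    p<last = ≤∧≢⇒< (≤fromℕ p) p≢last

    penultimate<last : penultimate n < fromℕ (suc n)
    penultimate<last = ≤̄⇒inject₁< ≤-refl

    q : Fin (2+ n)
    q = π ⟨$⟩ˡ p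

    π[q]≡p : π ⟨$⟩ʳ q ≡ p
    π[q]≡p = inverseʳ π

  below-p : ∀ {i} → i ≢ p → π ⟨$⟩ʳ i < π ⟨$⟩ʳ p
  below-p {i} i≢p = subst (π ⟨$⟩ʳ i <_) (sym π[p]≡max) (below-max π π[p]≡max i≢p)

  prefix<suffix : ∀ {i j} → i < p → p < j → π ⟨$⟩ʳ i < π ⟨$⟩ʳ j
  prefix<suffix i<p p<j = avoids-231⇒< π avoids-231 i<p p<j (below-p (<⇒≢ i<p))

  suffix-increasing : ∀ {i j} → p < i → i < j → π ⟨$⟩ʳ i < π ⟨$⟩ʳ j
  suffix-increasing p<i i<j = avoids-1432⇒< π avoids-1432 0<p p<i i<j
    (prefix<suffix 0<p (<-trans p<i i<j)) (below-p (<⇒≢ p<i ∘ sym))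

  last↦penultimate : π ⟨$⟩ʳ fromℕ (suc n) ≡ penultimate n
  last↦penultimate = second-largest π π[p]≡max (p≢last ∘ sym) below-last
    where
    below-last : ∀ {i} → i ≢ p → i ≢ fromℕ (suc n) → π ⟨$⟩ʳ i < π ⟨$⟩ʳ fromℕ (suc n)
    below-last {i} i≢p i≢last with <-cmp i p
    ... | tri< i<p _ _ = prefix<suffix i<p p<last
    ... | tri≈ _ i≡p _ = contradiction i≡p i≢p
    ... | tri> _ _ p<i = suffix-increasing p<i (≤∧≢⇒< (≤fromℕ i) i≢last)

  suffix-below-diagonal : ∀ {j} → p < j → π ⟨$⟩ʳ j < j
  suffix-below-diagonal = increasing⇒below-diagonal (π ⟨$⟩ʳ_) suffix-increasing
    (subst (_< fromℕ (suc n)) (sym last↦penultimate) penultimate<last)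

  value-p-not-left-of-p : ¬ q < p
  value-p-not-left-of-p q<p with <fromℕ⇒inject₁ p<last
  ... | p₀ , inject₁p₀≡p =
    ℕ.≤⇒≯ π[p+1]≤p (subst (_< π ⟨$⟩ʳ suc p₀) π[q]≡p (prefix<suffix q<p p<p+1))
    where
    p<p+1 : p < suc p₀
    p<p+1 = subst (_< suc p₀) inject₁p₀≡p (≤̄⇒inject₁< ≤-refl)
    π[p+1]≤p : π ⟨$⟩ʳ suc p₀ ≤ p
    π[p+1]≤p = subst (π ⟨$⟩ʳ suc p₀ ≤_) inject₁p₀≡p (<⇒≤pred (suffix-below-diagonal p<p+1))

  value-p-not-at-p : q ≢ p
  value-p-not-at-p q≡p = p≢last (begin
    p                ≡⟨ sym π[q]≡p ⟩
    π ⟨$⟩ʳ q         ≡⟨ cong (π ⟨$⟩ʳ_) q≡p ⟩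
    π ⟨$⟩ʳ p         ≡⟨ π[p]≡max ⟩
    fromℕ (suc n)    ∎)

  p≢penultimate⇒square-contains-231 : p ≢ penultimate n →
    Contains (λ i → π ⟨$⟩ʳ (π ⟨$⟩ʳ i)) p231
  p≢penultimate⇒square-contains-231 p≢pen with <-cmp q p
  ... | tri< q<p _ _ = contradiction q<p value-p-not-left-of-p
  ... | tri≈ _ q≡p _ = contradiction q≡p value-p-not-at-p
  ... | tri> _ _ p<q = contains-231 (λ i → π ⟨$⟩ʳ (π ⟨$⟩ʳ i)) p<q q<last
        (subst₂ _<_ (cong (π ⟨$⟩ʳ_) (sym last↦penultimate)) (cong (π ⟨$⟩ʳ_) (sym π[p]≡max))
           (suffix-increasing p<pen penultimate<last))
        (subst₂ _<_ (cong (π ⟨$⟩ʳ_) (sym π[p]≡max)) (cong (π ⟨$⟩ʳ_) (sym π[q]≡p))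
           (below-p (p≢last ∘ sym)))
    where
    p<pen : p < penultimate n
    p<pen = ≤∧≢⇒< (<⇒≤pred p<last) p≢pen
    q≢last : q ≢ fromℕ (suc n)
    q≢last q≡last = p≢pen (begin
      p                         ≡⟨ sym π[q]≡p ⟩
      π ⟨$⟩ʳ q                  ≡⟨ cong (π ⟨$⟩ʳ_) q≡last ⟩
      π ⟨$⟩ʳ fromℕ (suc n)      ≡⟨ last↦penultimate ⟩
      penultimate n             ∎)
    q<last : q < fromℕ (suc n)
    q<last = ≤∧≢⇒< (≤fromℕ q) q≢last

lemma2p1 : (m : ℕ) (π : Permutation′ (suc (suc (suc m)))) →
    Avoids (π ⟨$⟩ʳ_) p231 → Avoids (π ⟨$⟩ʳ_) p1432 →
    Avoids (λ i → π ⟨$⟩ʳ (π ⟨$⟩ʳ i)) p231 →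
    (π ⟨$⟩ʳ zero ≡ fromℕ (suc (suc m)))
    ⊎ (π ⟨$⟩ʳ fromℕ (suc (suc m)) ≡ fromℕ (suc (suc m)))
    ⊎ ((π ⟨$⟩ʳ inject₁ (fromℕ (suc m)) ≡ fromℕ (suc (suc m)))
       × (π ⟨$⟩ʳ fromℕ (suc (suc m)) ≡ inject₁ (fromℕ (suc m))))
lemma2p1 m π avoids-231 avoids-1432 square-avoids-231
  with π ⟨$⟩ˡ fromℕ (2+ m) | inverseʳ π {fromℕ (2+ m)}
... | p | π[p]≡max with p ≟ zero | p ≟ fromℕ (2+ m) | p ≟ penultimate (suc m)
... | yes refl | _         | _        = inj₁ π[p]≡max
... | no _     | yes refl  | _        = inj₂ (inj₁ π[p]≡max)
... | no p≢0   | no p≢last | yes refl = inj₂ (inj₂ (π[p]≡max , last↦penultimate))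
  where open InteriorMaximum π avoids-231 avoids-1432 π[p]≡max p≢0 p≢last
... | no p≢0   | no p≢last | no p≢pen =
  contradiction (p≢penultimate⇒square-contains-231 p≢pen) square-avoids-231
  where open InteriorMaximum π avoids-231 avoids-1432 π[p]≡max p≢0 p≢last
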